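{- For every integer $n \geq 3$, $\sigma(\mathrm{GP}(n,1)) = 3$.
   Context: Surrounding Cops and Robbers on a finite simple graph $G$ with $k \geq 1$ cops and one robber: the cops first choose starting vertices (several cops may share a vertex), then the robber chooses a starting vertex not occupied by a cop, and thereafter the cops and the robber alternate moves, the cops moving first. In a move, each player may move to an adjacent vertex or stay put; the robber may never move to, or remain on, a vertex occupied by a cop, so if a cop moves onto the robber's vertex the robber is compelled to move to a neighbouring vertex not occupied by a cop. The cops win if at any time every neighbour of the robber's vertex is occupied by a cop; the robber wins if he avoids this forever. Play is with perfect information. The surrounding cop number $\sigma(G)$ is the least number of cops for which the cops have a winning strategy. $\mathrm{GP}(n,1)$ (the prism) has vertex set $\{a_0,\dots,a_{n-1}\} \cup \{b_0,\dots,b_{n-1}\}$ and edges $\{a_i,a_{i+1}\}$, $\{a_i,b_i\}$, $\{b_i,b_{i+1}\}$ for each $i$, subscripts modulo $n$. -}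

module Defs where

open import Data.Nat using (ℕ; zero; suc; _≤_; _<_)
open import Data.Fin using (Fin; toℕ)
open import Data.Product using (Σ; ∃; _×_; _,_; proj₁; proj₂)
open import Data.Sum using (_⊎_)
open import Data.List using (List; []; _∷_)
open import Relation.Binary.PropositionalEquality using (_≡_)
open import Relation.Nullary using (¬_)

module Game {V : Set} (Adj : V → V → Set) where

  -- positions of k cops (several cops may share a vertex)
  CopPos : ℕ → Set
  CopPos k = Fin k → V

  Step : V → V → Set
  Step u v = u ≡ v ⊎ Adj u v

  Occupied : ∀ {k} → CopPos k → V → Set
  Occupied c v = ∃ λ i → c i ≡ v

  Surrounded : ∀ {k} → CopPos k → V → Set
  Surrounded c r = ∀ v → Adj r v → Occupied c v

  State : ℕ → Set
  State k = CopPos k × V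

  -- the earlier states of the play, most recent first
  History : ℕ → Set
  History k = List (State k)

  record CopStrategy (k : ℕ) : Set where
    field
      start : CopPos k
      move  : History k → State k → CopPos k
      legal : ∀ h s i → Step (proj₁ s i) (move h s i)

  -- Legality of the robber's choices is
  -- NOT built in: an illegal choice counts as a loss for the robber
  -- (see CopsWinAt).
  record RobberStrategy (k : ℕ) : Set where
    field
      start : CopPos k → V
      move  : History k → State k → CopPos k → V

  module Play {k : ℕ} (σc : CopStrategy k) (σr : RobberStrategy k) where
    open CopStrategy σc renaming (start to cstart; move to cmove)
    open RobberStrategy σr renaming (start to rstart; move to rmove)

    initial : State k
    initial = cstart , rstart cstart

    next : History k → State k → State k
    next h s = cmove h s , rmove h s (cmove h s)

    run : ℕ → History k × State k
    run zero    = [] , initial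
    run (suc t) = (proj₂ (run t) ∷ proj₁ (run t)) , next (proj₁ (run t)) (proj₂ (run t))

    state : ℕ → State k
    state t = proj₂ (run t)

    -- The cops have won at time t.
    -- t = 0 : the robber chose an occupied start, or is surrounded.
    -- t+1   : after the cops' move the robber is surrounded; or the
    --         robber's reply is illegal (not a step, or onto a cop);
    --         or after the robber's reply he is surrounded.
    CopsWinAt : ℕ → Set
    CopsWinAt zero = Occupied (proj₁ (state zero)) (proj₂ (state zero))
                   ⊎ Surrounded (proj₁ (state zero)) (proj₂ (state zero))
    CopsWinAt (suc t) =
        Surrounded (proj₁ (state (suc t))) (proj₂ (state t))
      ⊎ ¬ Step (proj₂ (state t)) (proj₂ (state (suc t)))
      ⊎ Occupied (proj₁ (state (suc t))) (proj₂ (state (suc t)))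
      ⊎ Surrounded (proj₁ (state (suc t))) (proj₂ (state (suc t)))

  CopsWin : ℕ → Set
  CopsWin k = Σ (CopStrategy k) λ σc → (σr : RobberStrategy k) →
                ∃ λ t → Play.CopsWinAt σc σr t

  IsSurroundingCopNumber : ℕ → Set
  IsSurroundingCopNumber m = CopsWin m × (∀ k → 1 ≤ k → k < m → ¬ CopsWin k)

CycAdj : (n : ℕ) → Fin n → Fin n → Set
CycAdj n i j = suc (toℕ i) ≡ toℕ j
             ⊎ suc (toℕ j) ≡ toℕ i
             ⊎ (toℕ i ≡ 0 × suc (toℕ j) ≡ n)
             ⊎ (toℕ j ≡ 0 × suc (toℕ i) ≡ n)

data GPVertex (n : ℕ) : Set where
  a : Fin n → GPVertex n
  b : Fin n → GPVertex n

data GPAdj (n : ℕ) : GPVertex n → GPVertex n → Set where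
  aa : ∀ {i j} → CycAdj n i j → GPAdj n (a i) (a j)
  bb : ∀ {i j} → CycAdj n i j → GPAdj n (b i) (b j)
  ab : ∀ {i} → GPAdj n (a i) (b i)
  ba : ∀ {i} → GPAdj n (b i) (a i)

module Submission where

-- Lower bound (module FewCopsLose, for any graph in which every vertex has
-- three distinct neighbours): by pigeonhole at most two cops never cover all
-- three neighbours of the robber, so a robber who only moves when a cop lands
-- on him always has a free vertex to go to and is never surrounded.
--
-- Upper bound (module Prism): read the prism as columns 0..N of two rows.
-- Cops 0 and 1 form a wall on both vertices of a column w, cop 2 stands at
-- column c ≤ N (initially w = 0 and c = N ≡ 0), and the robber is confined to
-- a column strictly between.  Each round the wall advances or cop 2 steps towards the robber,
-- so his room c − w − 2 shrinks (closeIn), and his replies cannot enlarge it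
-- (robberReply); a well-founded induction (trap) ends in a surrounding,
-- possibly via one "staggered" round (staggeredWins).

open import Defs
open import Data.Bool using (Bool; true; false; not)
import Data.Bool.Properties as Bool
open import Data.Nat using (ℕ; zero; suc; _+_; _≤_)
open import Data.Nat.Base using (_<_; _∸_; pred; z≤n; s≤s)
open import Data.Nat.Properties
  using (suc-injective; m≤n⇒m<n∨m≡n; ≤-trans; n≤1+n; m≤n+m; +-suc; +-identityʳ; +-monoʳ-≤;
         n∸n≡0; m+n∸n≡m; m∸n+n≡m; m≤n⇒m∸n≡0)
import Data.Nat.Properties as ℕ
open import Data.Nat.DivMod using (_mod_; m<n⇒m%n≡m; n%n≡0)
open import Data.Fin using (Fin; toℕ; fromℕ; inject₁) renaming (zero to fzero; suc to fsuc)
open import Data.Fin.Properties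
  using (any?; ¬∀⟶∃¬; pigeonhole; toℕ-injective; toℕ<n; toℕ-fromℕ<; toℕ-fromℕ; toℕ-inject₁)
import Data.Fin.Properties as Fin
open import Data.Product using (∃; _×_; _,_; proj₁; proj₂)
open import Data.Sum using (_⊎_; inj₁; inj₂)
open import Function using (_∘_)
open import Function.Definitions using (Injective)
open import Relation.Binary.Definitions using (DecidableEquality)
open import Relation.Binary.PropositionalEquality using (_≡_; _≢_; _≗_; refl; sym; trans; cong; cong₂; subst; module ≡-Reasoning)
open import Data.Empty using (⊥-elim)
open import Relation.Nullary using (¬_; Dec; yes; no; does)
open import Relation.Nullary.Decidable using (_×-dec_; _⊎-dec_; map′)

-- The robber starts on a free neighbour of
-- some vertex and afterwards stays put unless a cop steps on him, in which
-- case he flees to a free neighbour; two cops can cover at most two of his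
-- three neighbours, so he is never surrounded and always has a legal move.
module FewCopsLose
  {V : Set} {Adj : V → V → Set} (_≟_ : DecidableEquality V)
  (nbr : V → Fin 3 → V)
  (nbr-adjacent : ∀ v i → Adj v (nbr v i))
  (nbr-distinct : ∀ v → Injective _≡_ _≡_ (nbr v))
  where

  open Game Adj

  occupied? : ∀ {k} (cs : CopPos k) (v : V) → Dec (Occupied cs v)
  occupied? cs v = any? (λ i → cs i ≟ v)

  notAllOccupied : ∀ {k} → k < 3 → (cs : CopPos k) (u : Fin 3 → V) →
                   Injective _≡_ _≡_ u → ¬ (∀ i → Occupied cs (u i))
  notAllOccupied k<3 cs u u-inj occ with pigeonhole k<3 (proj₁ ∘ occ)
  ... | i , j , i<j , sameCop =
    Fin.<⇒≢ i<j (u-inj (trans (sym (proj₂ (occ i))) (trans (cong cs sameCop) (proj₂ (occ j)))))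

  freeAmong : ∀ {k} → k < 3 → (cs : CopPos k) (u : Fin 3 → V) →
              Injective _≡_ _≡_ u → ∃ λ i → ¬ Occupied cs (u i)
  freeAmong k<3 cs u u-inj = ¬∀⟶∃¬ 3 _ (occupied? cs ∘ u) (notAllOccupied k<3 cs u u-inj)

  neverSurrounded : ∀ {k} → k < 3 → (cs : CopPos k) (v : V) → ¬ Surrounded cs v
  neverSurrounded k<3 cs v surr =
    notAllOccupied k<3 cs (nbr v) (nbr-distinct v) (λ i → surr (nbr v i) (nbr-adjacent v i))

  escape : ∀ {k} → k < 3 → (cs : CopPos k) (v : V) → ∃ λ u → Step v u × ¬ Occupied cs u
  escape k<3 cs v with occupied? cs v
  ... | no free = v , inj₁ refl , free
  ... | yes _   with freeAmong k<3 cs (nbr v) (nbr-distinct v)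
  ...   | i , free = nbr v i , inj₂ (nbr-adjacent v i) , free

  evader : ∀ {k} → k < 3 → V → RobberStrategy k
  evader k<3 v₀ = record
    { start = λ cs → nbr v₀ (proj₁ (freeAmong k<3 cs (nbr v₀) (nbr-distinct v₀)))
    ; move  = λ _ s cs → proj₁ (escape k<3 cs (proj₂ s))
    }

  fewCopsLose : V → ∀ {k} → k < 3 → ¬ CopsWin k
  fewCopsLose v₀ k<3 (σ , wins) with wins (evader k<3 v₀)
  ... | t , won = evades t won
    where
    open Play σ (evader k<3 v₀)
    evades : ∀ t → ¬ CopsWinAt t
    evades zero    (inj₁ occ)  = proj₂ (freeAmong k<3 _ (nbr v₀) (nbr-distinct v₀)) occ
    evades zero    (inj₂ surr) = neverSurrounded k<3 _ _ surr
    evades (suc t) (inj₁ surr) = neverSurrounded k<3 _ _ surr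
    evades (suc t) (inj₂ (inj₁ illegal)) = illegal (proj₁ (proj₂ (escape k<3 _ _)))
    evades (suc t) (inj₂ (inj₂ (inj₁ occ))) = proj₂ (proj₂ (escape k<3 _ _)) occ
    evades (suc t) (inj₂ (inj₂ (inj₂ surr))) = neverSurrounded k<3 _ _ surr

module Prism (n' : ℕ) where

  N : ℕ
  N = suc (suc (suc n'))

  V : Set
  V = GPVertex N

  open Game (GPAdj N)

  cl : ℕ → Fin N
  cl k = k mod N

  toℕ-cl : ∀ {k} → k < N → toℕ (cl k) ≡ k
  toℕ-cl k<N = trans (toℕ-fromℕ< _) (m<n⇒m%n≡m k<N)

  toℕ-clN : toℕ (cl N) ≡ 0
  toℕ-clN = trans (toℕ-fromℕ< _) (n%n≡0 N)

  cl-toℕ : ∀ (i : Fin N) → cl (toℕ i) ≡ i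
  cl-toℕ i = toℕ-injective (toℕ-cl (toℕ<n i))

  nextF prevF : Fin N → Fin N
  nextF i = cl (suc (toℕ i))
  prevF fzero    = fromℕ (suc (suc n'))
  prevF (fsuc i) = inject₁ i

  toℕ-nextF : ∀ i → (suc (toℕ i) < N × toℕ (nextF i) ≡ suc (toℕ i))
                  ⊎ (suc (toℕ i) ≡ N × toℕ (nextF i) ≡ 0)
  toℕ-nextF i with m≤n⇒m<n∨m≡n (toℕ<n i)
  ... | inj₁ lt = inj₁ (lt , toℕ-cl lt)
  ... | inj₂ eq = inj₂ (eq , trans (cong (toℕ ∘ cl) eq) toℕ-clN)

  next-adj : ∀ i → CycAdj N i (nextF i)
  next-adj i with toℕ-nextF i
  ... | inj₁ (_ , e)  = inj₁ (sym e)
  ... | inj₂ (eq , e) = inj₂ (inj₂ (inj₂ (e , eq)))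

  prev-adj : ∀ i → CycAdj N i (prevF i)
  prev-adj fzero    = inj₂ (inj₂ (inj₁ (refl , cong suc (toℕ-fromℕ _))))
  prev-adj (fsuc i) = inj₂ (inj₁ (cong suc (toℕ-inject₁ i)))

  cyc-neighbours : ∀ {i j} → CycAdj N i j → j ≡ nextF i ⊎ j ≡ prevF i
  cyc-neighbours {i} {j} (inj₁ p) =
    inj₁ (toℕ-injective (trans (sym p) (sym (toℕ-cl (subst (_< N) (sym p) (toℕ<n j))))))
  cyc-neighbours {fsuc i} (inj₂ (inj₁ p)) =
    inj₂ (toℕ-injective (trans (suc-injective p) (sym (toℕ-inject₁ i))))
  cyc-neighbours {fzero} (inj₂ (inj₂ (inj₁ (_ , q)))) =
    inj₂ (toℕ-injective (trans (suc-injective q) (sym (toℕ-fromℕ _))))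
  cyc-neighbours {i} (inj₂ (inj₂ (inj₂ (p , q)))) =
    inj₁ (toℕ-injective (trans p (sym (trans (cong (toℕ ∘ cl) q) toℕ-clN))))

  next≢prev : ∀ i → nextF i ≢ prevF i
  next≢prev fzero eq with trans (sym (toℕ-cl (s≤s (s≤s z≤n)))) (trans (cong toℕ eq) (toℕ-fromℕ _))
  ... | ()
  next≢prev (fsuc i) eq with toℕ-nextF (fsuc i) | trans (cong toℕ eq) (toℕ-inject₁ i)
  ... | inj₁ (_ , e)    | e' = ℕ.<⇒≢ (ℕ.m<n+m (toℕ i) (s≤s z≤n)) (sym (trans (sym e) e'))
  ... | inj₂ (wrap , e) | e' with trans (cong (suc ∘ suc) (trans (sym e) e')) wrap
  ...   | ()

  along : (Fin N → Fin N) → V → V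
  along f (a i) = a (f i)
  along f (b i) = b (f i)

  across forward backward : V → V
  across (a i) = b i
  across (b i) = a i
  forward  = along nextF
  backward = along prevF

  nbr : V → Fin 3 → V
  nbr v fzero               = across v
  nbr v (fsuc fzero)        = forward v
  nbr v (fsuc (fsuc fzero)) = backward v

  along-adj : ∀ {f} → (∀ i → CycAdj N i (f i)) → ∀ v → GPAdj N v (along f v)
  along-adj f-adj (a i) = aa (f-adj i)
  along-adj f-adj (b i) = bb (f-adj i)

  nbr-adjacent : ∀ v i → GPAdj N v (nbr v i)
  nbr-adjacent (a i) fzero = ab
  nbr-adjacent (b i) fzero = ba
  nbr-adjacent v (fsuc fzero)        = along-adj next-adj v
  nbr-adjacent v (fsuc (fsuc fzero)) = along-adj prev-adj v

  forward≢backward : ∀ v → forward v ≢ backward v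
  forward≢backward (a i) eq = next≢prev i (a-injective eq)
    where a-injective : ∀ {p q} → GPVertex.a {N} p ≡ a q → p ≡ q
          a-injective refl = refl
  forward≢backward (b i) eq = next≢prev i (b-injective eq)
    where b-injective : ∀ {p q} → GPVertex.b {N} p ≡ b q → p ≡ q
          b-injective refl = refl

  nbr-distinct : ∀ v → Injective _≡_ _≡_ (nbr v)
  nbr-distinct v {fzero} {fzero} _ = refl
  nbr-distinct v {fsuc fzero} {fsuc fzero} _ = refl
  nbr-distinct v {fsuc (fsuc fzero)} {fsuc (fsuc fzero)} _ = refl
  nbr-distinct (a i) {fzero} {fsuc fzero} ()
  nbr-distinct (b i) {fzero} {fsuc fzero} ()
  nbr-distinct (a i) {fzero} {fsuc (fsuc fzero)} ()
  nbr-distinct (b i) {fzero} {fsuc (fsuc fzero)} ()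
  nbr-distinct (a i) {fsuc fzero} {fzero} ()
  nbr-distinct (b i) {fsuc fzero} {fzero} ()
  nbr-distinct (a i) {fsuc (fsuc fzero)} {fzero} ()
  nbr-distinct (b i) {fsuc (fsuc fzero)} {fzero} ()
  nbr-distinct v {fsuc fzero} {fsuc (fsuc fzero)} eq = ⊥-elim (forward≢backward v eq)
  nbr-distinct v {fsuc (fsuc fzero)} {fsuc fzero} eq = ⊥-elim (forward≢backward v (sym eq))

  neighbours : ∀ {u v} → GPAdj N u v → v ≡ across u ⊎ v ≡ forward u ⊎ v ≡ backward u
  neighbours ab = inj₁ refl
  neighbours ba = inj₁ refl
  neighbours (aa p) with cyc-neighbours p
  ... | inj₁ refl = inj₂ (inj₁ refl)
  ... | inj₂ refl = inj₂ (inj₂ refl)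
  neighbours (bb p) with cyc-neighbours p
  ... | inj₁ refl = inj₂ (inj₁ refl)
  ... | inj₂ refl = inj₂ (inj₂ refl)

  _≟V_ : DecidableEquality V
  a i ≟V a j = map′ (cong a) (λ { refl → refl }) (i Fin.≟ j)
  b i ≟V b j = map′ (cong b) (λ { refl → refl }) (i Fin.≟ j)
  a i ≟V b j = no λ ()
  b i ≟V a j = no λ ()

  cycAdj? : ∀ i j → Dec (CycAdj N i j)
  cycAdj? i j = (suc (toℕ i) ℕ.≟ toℕ j) ⊎-dec (suc (toℕ j) ℕ.≟ toℕ i)
              ⊎-dec ((toℕ i ℕ.≟ 0) ×-dec (suc (toℕ j) ℕ.≟ N))
              ⊎-dec ((toℕ j ℕ.≟ 0) ×-dec (suc (toℕ i) ℕ.≟ N))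

  adj? : ∀ u v → Dec (GPAdj N u v)
  adj? (a i) (a j) = map′ aa (λ { (aa p) → p }) (cycAdj? i j)
  adj? (b i) (b j) = map′ bb (λ { (bb p) → p }) (cycAdj? i j)
  adj? (a i) (b j) = map′ (λ { refl → ab }) (λ { ab → refl }) (i Fin.≟ j)
  adj? (b i) (a j) = map′ (λ { refl → ba }) (λ { ba → refl }) (i Fin.≟ j)

  step? : ∀ u v → Dec (Step u v)
  step? u v = (u ≟V v) ⊎-dec adj? u v

  -- Coordinates: vx y k is the vertex in row y (true = a, false = b) and
  -- column k mod N.  The third cop's column is read in 1..N (highCol), so
  -- that it can sit "just behind the wall" at column N ≡ 0.

  vx : Bool → ℕ → V
  vx true  k = a (cl k)
  vx false k = b (cl k)

  rowOf : V → Bool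
  rowOf (a _) = true
  rowOf (b _) = false

  colOf : V → ℕ
  colOf (a i) = toℕ i
  colOf (b i) = toℕ i

  highCol : ℕ → ℕ
  highCol zero    = N
  highCol (suc k) = suc k

  row-vx : ∀ y k → rowOf (vx y k) ≡ y
  row-vx true  k = refl
  row-vx false k = refl

  col-vx : ∀ y {k} → k < N → colOf (vx y k) ≡ k
  col-vx true  k<N = toℕ-cl k<N
  col-vx false k<N = toℕ-cl k<N

  highCol-vx : ∀ y {c} → 1 ≤ c → c ≤ N → highCol (colOf (vx y c)) ≡ c
  highCol-vx y {suc c} _ c≤N with m≤n⇒m<n∨m≡n c≤N
  ... | inj₁ lt   = cong highCol (col-vx y lt)
  ... | inj₂ refl = cong highCol (colN y)
    where colN : ∀ y → colOf (vx y N) ≡ 0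
          colN true  = toℕ-clN
          colN false = toℕ-clN

  toℕ-prevF : ∀ j → toℕ (prevF j) ≡ pred (highCol (toℕ j))
  toℕ-prevF fzero    = toℕ-fromℕ _
  toℕ-prevF (fsuc i) = toℕ-inject₁ i

  nextF-cl : ∀ {k} → k < N → nextF (cl k) ≡ cl (suc k)
  nextF-cl k<N = cong (cl ∘ suc) (toℕ-cl k<N)

  prevF-cl : ∀ {c} → 1 ≤ c → c ≤ N → prevF (cl c) ≡ cl (pred c)
  prevF-cl {suc c} 1≤c c≤N = toℕ-injective (begin
    toℕ (prevF (cl (suc c)))               ≡⟨ toℕ-prevF (cl (suc c)) ⟩
    pred (highCol (colOf (vx true (suc c)))) ≡⟨ cong pred (highCol-vx true 1≤c c≤N) ⟩
    c                                       ≡⟨ sym (toℕ-cl c≤N) ⟩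
    toℕ (cl c)                              ∎)
    where open ≡-Reasoning

  along-vx : ∀ {f} y {k k'} → f (cl k) ≡ cl k' → along f (vx y k) ≡ vx y k'
  along-vx true  e = cong a e
  along-vx false e = cong b e

  across-vx : ∀ y k → across (vx y k) ≡ vx (not y) k
  across-vx true  k = refl
  across-vx false k = refl

  forward-vx : ∀ y {k} → k < N → forward (vx y k) ≡ vx y (suc k)
  forward-vx y k<N = along-vx y (nextF-cl k<N)

  backward-vx : ∀ y {c} → 1 ≤ c → c ≤ N → backward (vx y c) ≡ vx y (pred c)
  backward-vx y 1≤c c≤N = along-vx y (prevF-cl 1≤c c≤N)

  neighbours-vx : ∀ x {k u} → suc k < N → GPAdj N (vx x (suc k)) u →
                  u ≡ vx (not x) (suc k) ⊎ u ≡ vx x (suc (suc k)) ⊎ u ≡ vx x k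
  neighbours-vx x {k} k+1<N adj with neighbours adj
  ... | inj₁ refl        = inj₁ (across-vx x (suc k))
  ... | inj₂ (inj₁ refl) = inj₂ (inj₁ (forward-vx x k+1<N))
  ... | inj₂ (inj₂ refl) = inj₂ (inj₂ (backward-vx x (s≤s z≤n) (ℕ.<⇒≤ k+1<N)))

  surrounded-at : ∀ {j} {C : CopPos j} x {k} → suc k < N →
                  Occupied C (vx (not x) (suc k)) → Occupied C (vx x (suc (suc k))) →
                  Occupied C (vx x k) → Surrounded C (vx x (suc k))
  surrounded-at x k+1<N across-occ forward-occ backward-occ u adj with neighbours-vx x k+1<N adj
  ... | inj₁ refl        = across-occ
  ... | inj₂ (inj₁ refl) = forward-occ
  ... | inj₂ (inj₂ refl) = backward-occ

  data Reply (x : Bool) (k : ℕ) (u : V) : Set where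
    stays    : u ≡ vx x (suc k)        → Reply x k u
    crosses  : u ≡ vx (not x) (suc k)  → Reply x k u
    advances : u ≡ vx x (suc (suc k))  → Reply x k u
    retreats : u ≡ vx x k              → Reply x k u

  reply? : ∀ x {k} → suc k < N → ∀ u → ¬ Step (vx x (suc k)) u ⊎ Reply x k u
  reply? x {k} k+1<N u with step? (vx x (suc k)) u
  ... | no illegal         = inj₁ illegal
  ... | yes (inj₁ refl)    = inj₂ (stays refl)
  ... | yes (inj₂ adj) with neighbours-vx x k+1<N adj
  ...   | inj₁ e        = inj₂ (crosses e)
  ...   | inj₂ (inj₁ e) = inj₂ (advances e)
  ...   | inj₂ (inj₂ e) = inj₂ (retreats e)

  -- Cops 0 and 1 form a "wall" in rows a and b; they only
  -- ever step forward (increasing column).  Cop 2 closes in from the far side: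
  -- it steps back (decreasing column), stays, or switches to a given row.

  data Move₃ : Set where
    stay back : Move₃
    toRow     : Bool → Move₃

  record Orders : Set where
    constructor orders
    field
      advance₀ advance₁ : Bool
      third             : Move₃

  open Orders

  formation : ℕ → ℕ → Bool → ℕ → CopPos 3
  formation w₀ w₁ m c fzero               = vx true w₀
  formation w₀ w₁ m c (fsuc fzero)        = vx false w₁
  formation w₀ w₁ m c (fsuc (fsuc fzero)) = vx m c

  hold : Orders
  hold = orders false false back

  push : Move₃ → Orders
  push = orders true true

  -- with the robber in row x next to the wall: the wall cop of the other row
  -- steps forward and the third cop enters row x
  squeeze : Bool → Orders
  squeeze x = orders (not x) x (toRow x)

  -- Orders when the wall is aligned, the robber is in row x with g free
  -- columns between him and the wall, h free columns between him and the
  -- third cop, and 'same' tells whether the third cop is in row x.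
  -- Next to the wall (g = 0) the cops squeeze if that surrounds him or
  -- staggers the wall, and otherwise the third cop steps back.  Further away
  -- the wall advances and the third cop steps back, unless it would end up
  -- next to the robber in the other row: then it switches to his row.
  approach : ℕ → Bool → Bool → Move₃
  approach (suc (suc _)) _    _ = back
  approach (suc zero)    true _ = back
  approach _             _    x = toRow x

  aligned : ℕ → ℕ → Bool → Bool → Orders
  aligned zero    zero        _     x = squeeze x
  aligned zero    (suc zero)  false x = squeeze x
  aligned zero    _           _     _ = hold
  aligned (suc _) h           same  x = push (approach h same x)

  -- Orders when the wall is staggered (one wall cop a column ahead).
  staggered : ℕ → Orders
  staggered (suc zero) = hold
  staggered _          = push stay

  -- The first two arguments are the two differences of the wall columns.
  decide : ℕ → ℕ → ℕ → ℕ → Bool → Bool → Orders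
  decide zero zero g h same x = aligned g h same x
  decide _    _    _ h _    _ = staggered h

  ordersFor : V → V → V → V → Orders
  ordersFor u₀ u₁ u₂ v =
    decide (colOf u₀ ∸ colOf u₁) (colOf u₁ ∸ colOf u₀)
           (colOf v ∸ suc (colOf u₀)) (highCol (colOf u₂) ∸ suc (colOf v))
           (does (rowOf u₂ Bool.≟ rowOf v)) (rowOf v)

  advanceIf : Bool → V → V
  advanceIf false v = v
  advanceIf true  v = forward v

  setRow : Bool → V → V
  setRow true  (a i) = a i
  setRow true  (b i) = a i
  setRow false (a i) = b i
  setRow false (b i) = b i

  move₃ : Move₃ → V → V
  move₃ stay      v = v
  move₃ back      v = backward v
  move₃ (toRow y) v = setRow y v

  apply : Orders → CopPos 3 → CopPos 3
  apply o cs fzero               = advanceIf (advance₀ o) (cs fzero)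
  apply o cs (fsuc fzero)        = advanceIf (advance₁ o) (cs (fsuc fzero))
  apply o cs (fsuc (fsuc fzero)) = move₃ (third o) (cs (fsuc (fsuc fzero)))

  respond : CopPos 3 → V → CopPos 3
  respond cs v = apply (ordersFor (cs fzero) (cs (fsuc fzero)) (cs (fsuc (fsuc fzero))) v) cs

  advanceIf-step : ∀ d v → Step v (advanceIf d v)
  advanceIf-step false v = inj₁ refl
  advanceIf-step true  v = inj₂ (nbr-adjacent v (fsuc fzero))

  move₃-step : ∀ o v → Step v (move₃ o v)
  move₃-step stay          v     = inj₁ refl
  move₃-step back          v     = inj₂ (nbr-adjacent v (fsuc (fsuc fzero)))
  move₃-step (toRow true)  (a i) = inj₁ refl
  move₃-step (toRow true)  (b i) = inj₂ ba
  move₃-step (toRow false) (a i) = inj₂ ab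
  move₃-step (toRow false) (b i) = inj₁ refl

  apply-legal : ∀ o cs i → Step (cs i) (apply o cs i)
  apply-legal o cs fzero               = advanceIf-step (advance₀ o) (cs fzero)
  apply-legal o cs (fsuc fzero)        = advanceIf-step (advance₁ o) (cs (fsuc fzero))
  apply-legal o cs (fsuc (fsuc fzero)) = move₃-step (third o) (cs (fsuc (fsuc fzero)))

  -- Initially the wall stands on column 0 and the third cop on column N ≡ 0.
  strategy : CopStrategy 3
  strategy = record
    { start = formation 0 0 true N
    ; move  = λ _ s → respond (proj₁ s) (proj₂ s)
    ; legal = λ _ s → apply-legal _ (proj₁ s)
    }

  bump : Bool → ℕ → ℕ
  bump false k = k
  bump true  k = suc k

  rowAfter : Move₃ → Bool → Bool
  rowAfter (toRow y) _ = y
  rowAfter _         m = m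

  colAfter : Move₃ → ℕ → ℕ
  colAfter back c = pred c
  colAfter _    c = c

  after : Orders → ℕ → ℕ → Bool → ℕ → CopPos 3
  after o w₀ w₁ m c = formation (bump (advance₀ o) w₀) (bump (advance₁ o) w₁)
                                (rowAfter (third o) m) (colAfter (third o) c)

  advanceIf-vx : ∀ d y {k} → k < N → advanceIf d (vx y k) ≡ vx y (bump d k)
  advanceIf-vx false y _   = refl
  advanceIf-vx true  y k<N = forward-vx y k<N

  setRow-vx : ∀ y m c → setRow y (vx m c) ≡ vx y c
  setRow-vx true  true  c = refl
  setRow-vx true  false c = refl
  setRow-vx false true  c = refl
  setRow-vx false false c = refl

  move₃-vx : ∀ o m {c} → 1 ≤ c → c ≤ N → move₃ o (vx m c) ≡ vx (rowAfter o m) (colAfter o c)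
  move₃-vx stay      m _   _   = refl
  move₃-vx back      m 1≤c c≤N = backward-vx m 1≤c c≤N
  move₃-vx (toRow y) m {c} _ _ = setRow-vx y m c

  apply-formation : ∀ {cs w₀ w₁ m c} → cs ≗ formation w₀ w₁ m c →
                    w₀ < N → w₁ < N → 1 ≤ c → c ≤ N →
                    ∀ o → apply o cs ≗ after o w₀ w₁ m c
  apply-formation cops w₀<N w₁<N 1≤c c≤N o fzero =
    trans (cong (advanceIf (advance₀ o)) (cops fzero)) (advanceIf-vx (advance₀ o) true w₀<N)
  apply-formation cops w₀<N w₁<N 1≤c c≤N o (fsuc fzero) =
    trans (cong (advanceIf (advance₁ o)) (cops (fsuc fzero))) (advanceIf-vx (advance₁ o) false w₁<N)
  apply-formation {m = m} cops w₀<N w₁<N 1≤c c≤N o (fsuc (fsuc fzero)) =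
    trans (cong (move₃ (third o)) (cops (fsuc (fsuc fzero)))) (move₃-vx (third o) m 1≤c c≤N)

  ordersFor-cong : ∀ {u₀ u₁ u₂ v u₀' u₁' u₂' v'} → u₀ ≡ u₀' → u₁ ≡ u₁' → u₂ ≡ u₂' → v ≡ v' →
                   ordersFor u₀ u₁ u₂ v ≡ ordersFor u₀' u₁' u₂' v'
  ordersFor-cong refl refl refl refl = refl

  ordersFor-vx : ∀ {w₀ w₁ m c x r} → w₀ < N → w₁ < N → 1 ≤ c → c ≤ N → r < N →
                 ordersFor (vx true w₀) (vx false w₁) (vx m c) (vx x r)
                 ≡ decide (w₀ ∸ w₁) (w₁ ∸ w₀) (r ∸ suc w₀) (c ∸ suc r) (does (m Bool.≟ x)) x
  ordersFor-vx {m = m} {c} {x} {r} w₀<N w₁<N 1≤c c≤N r<N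
    rewrite col-vx true w₀<N | col-vx false w₁<N | col-vx x r<N | highCol-vx m 1≤c c≤N
          | row-vx m c | row-vx x r = refl

  strategy-reply : ∀ {cs v w₀ w₁ m c x r o} → cs ≗ formation w₀ w₁ m c → v ≡ vx x r →
                   w₀ < N → w₁ < N → 1 ≤ c → c ≤ N → r < N →
                   decide (w₀ ∸ w₁) (w₁ ∸ w₀) (r ∸ suc w₀) (c ∸ suc r) (does (m Bool.≟ x)) x ≡ o →
                   respond cs v ≗ after o w₀ w₁ m c
  strategy-reply {cs} {v} {m = m} {o = o} cops robber w₀<N w₁<N 1≤c c≤N r<N decided i =
    trans (cong (λ o' → apply o' cs i) reading) (apply-formation cops w₀<N w₁<N 1≤c c≤N o i)
    where
    reading : ordersFor (cs fzero) (cs (fsuc fzero)) (cs (fsuc (fsuc fzero))) v ≡ o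
    reading = trans (ordersFor-cong (cops fzero) (cops (fsuc fzero)) (cops (fsuc (fsuc fzero))) robber)
                    (trans (ordersFor-vx {m = m} w₀<N w₁<N 1≤c c≤N r<N) decided)

  gap : ∀ g lo {hi} → hi ≡ suc g + lo → hi ∸ suc lo ≡ g
  gap g lo refl = m+n∸n≡m g lo

  decide-aligned : ∀ w g h same x → decide (w ∸ w) (w ∸ w) g h same x ≡ aligned g h same x
  decide-aligned w g h same x rewrite n∸n≡0 w = refl

  decide-staggered : ∀ x w g h same y →
    decide (bump (not x) w ∸ bump x w) (bump x w ∸ bump (not x) w) g h same y ≡ staggered h
  decide-staggered true  w g h same y rewrite m≤n⇒m∸n≡0 (n≤1+n w) | m+n∸n≡m 1 w = refl
  decide-staggered false w g h same y rewrite m+n∸n≡m 1 w = refl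

  robber<N : ∀ g h w → suc h + (suc g + w) ≤ N → suc g + w < N
  robber<N g h w fits = ≤-trans (s≤s (m≤n+m _ h)) fits

  shorten : ∀ {k} → suc k ≤ N → k ≤ N
  shorten = ≤-trans (n≤1+n _)

  shrink : ∀ g {h h'} → h' ≤ h → g + h' < suc g + h
  shrink g h'≤h = s≤s (+-monoʳ-≤ g h'≤h)

  aligned-reply : ∀ {cs v w g h m x} →
                  cs ≗ formation w w m (suc h + (suc g + w)) → v ≡ vx x (suc g + w) →
                  suc h + (suc g + w) ≤ N →
                  respond cs v ≗ after (aligned g h (does (m Bool.≟ x)) x) w w m (suc h + (suc g + w))
  aligned-reply {w = w} {g} {h} {m} {x} cops robber fits =
    strategy-reply cops robber w<N w<N (s≤s z≤n) fits r<N
      (trans (decide-aligned w _ _ _ x) (cong₂ (λ g' h' → aligned g' h' _ x) (gap g w refl) (gap h (suc g + w) refl)))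
    where
    r<N : suc g + w < N
    r<N = robber<N g h w fits
    w<N : w < N
    w<N = ℕ.<-trans (s≤s (m≤n+m w g)) r<N

  -- The cops' reply from a staggered wall (row-x cop at w, other at w+1).
  staggered-reply : ∀ {cs v w x h r} →
                    cs ≗ formation (bump (not x) w) (bump x w) x (suc h + r) → v ≡ vx x r →
                    suc w < N → suc h + r ≤ N →
                    respond cs v ≗ after (staggered h) (bump (not x) w) (bump x w) x (suc h + r)
  staggered-reply {w = w} {x} {h} {r} cops robber w+1<N fits =
    strategy-reply cops robber (bump-bound (not x)) (bump-bound x) (s≤s z≤n) fits
      (≤-trans (s≤s (m≤n+m _ h)) fits)
      (trans (decide-staggered x w _ _ _ x) (cong staggered (gap h r refl)))
    where
    bump-bound : ∀ d → bump d w < N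
    bump-bound false = ℕ.<-trans (ℕ.n<1+n w) w+1<N
    bump-bound true  = w+1<N

  wall-occupies : ∀ {C w m c} → C ≗ formation w w m c → ∀ y → Occupied C (vx y w)
  wall-occupies cops true  = fzero , cops fzero
  wall-occupies cops false = fsuc fzero , cops (fsuc fzero)

  staggered-wall : ∀ d {C x w m c} → C ≗ formation (bump d (bump (not x) w)) (bump d (bump x w)) m c →
                   Occupied C (vx x (bump d w)) × Occupied C (vx (not x) (suc (bump d w)))
  staggered-wall false {x = true}  cops = (fzero , cops fzero) , (fsuc fzero , cops (fsuc fzero))
  staggered-wall true  {x = true}  cops = (fzero , cops fzero) , (fsuc fzero , cops (fsuc fzero))
  staggered-wall false {x = false} cops = (fsuc fzero , cops (fsuc fzero)) , (fzero , cops fzero)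
  staggered-wall true  {x = false} cops = (fsuc fzero , cops (fsuc fzero)) , (fzero , cops fzero)

  squeezed : ∀ d {C x w} → suc (bump d w) < N →
             C ≗ formation (bump d (bump (not x) w)) (bump d (bump x w)) x (suc (suc (bump d w))) →
             Surrounded C (vx x (suc (bump d w)))
  squeezed d {x = x} k+1<N cops =
    surrounded-at x k+1<N (proj₂ wall) (fsuc (fsuc fzero) , cops (fsuc (fsuc fzero))) (proj₁ wall)
    where wall = staggered-wall d cops

  -- The invariant of the pursuit: an aligned wall at column w, the robber in
  -- row x at column r with g free columns behind him and h free columns ahead
  -- of him before the third cop's column c ≤ N.  The index s = g + h measures
  -- the robber's room; the cops shrink it every round.
  record Position (cs : CopPos 3) (v : V) (s : ℕ) : Set where
    constructor position
    field
      w r c g h : ℕ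
      m x       : Bool
      cops      : cs ≗ formation w w m c
      robber    : v ≡ vx x r
      left      : r ≡ suc g + w
      right     : c ≡ suc h + r
      span      : g + h ≡ s
      fits      : c ≤ N

  module Pursuit (σr : RobberStrategy 3) where
    open Play strategy σr

    Win : Set
    Win = ∃ CopsWinAt

    copsAt : ℕ → CopPos 3
    copsAt t = proj₁ (state t)

    robberAt : ℕ → V
    robberAt t = proj₂ (state t)

    surroundedByMove : ∀ t → Surrounded (copsAt (suc t)) (robberAt t) → Win
    surroundedByMove t surr = suc t , inj₁ surr

    illegalReply : ∀ t → ¬ Step (robberAt t) (robberAt (suc t)) → Win
    illegalReply t illegal = suc t , inj₂ (inj₁ illegal)

    caught : ∀ t {u} → Occupied (copsAt (suc t)) u → robberAt (suc t) ≡ u → Win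
    caught t occ refl = suc t , inj₂ (inj₂ (inj₁ occ))

    reply : ∀ t x {k} → suc k < N → robberAt t ≡ vx x (suc k) → Win ⊎ Reply x k (robberAt (suc t))
    reply t x k+1<N here with reply? x k+1<N (robberAt (suc t))
    ... | inj₁ illegal = inj₁ (illegalReply t (subst (λ u → ¬ Step u (robberAt (suc t))) (sym here) illegal))
    ... | inj₂ move    = inj₂ move

    -- Before the cops move, at time t.
    Cornered : ℕ → ℕ → Set
    Cornered t = Position (copsAt t) (robberAt t)

    -- After the cops' move in round t+1, before the robber's reply.  The guard
    -- says that a third cop right next to the robber is in his row.
    record Closing (t s : ℕ) : Set where
      constructor closing
      field
        pos   : Position (copsAt (suc t)) (robberAt t) s
        guard : Position.h pos ≡ 0 → Position.m pos ≡ Position.x pos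

    -- The robber at (x, w+1) faces a staggered wall ((x, w) and (¬x, w+1))
    -- and the third cop at (x, w+3): whether he stays or steps forward, the
    -- cops surround him in the following move.  (Entered from an aligned wall
    -- when the robber is next to it and the third cop two columns ahead of
    -- him in the other row.)
    staggeredWins : ∀ t w x →
                    copsAt (suc t) ≗ formation (bump (not x) w) (bump x w) x (suc (suc (suc w))) →
                    robberAt t ≡ vx x (suc w) → suc (suc (suc w)) ≤ N → Win
    staggeredWins t w x cops here fits = finish (reply t x w+1<N here)
      where
      w+1<N : suc w < N
      w+1<N = ≤-trans (n≤1+n _) fits
      finish : Win ⊎ Reply x w (robberAt (suc t)) → Win
      finish (inj₁ win) = win
      finish (inj₂ (stays e)) = surroundedByMove (suc t)
        (subst (Surrounded (copsAt (suc (suc t)))) (sym e) (squeezed false w+1<N (staggered-reply {h = 1} cops e w+1<N fits)))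
      finish (inj₂ (advances e)) = surroundedByMove (suc t)
        (subst (Surrounded (copsAt (suc (suc t)))) (sym e) (squeezed true fits (staggered-reply {h = 0} cops e w+1<N fits)))
      finish (inj₂ (crosses e))  = caught t (proj₂ (staggered-wall false cops)) e
      finish (inj₂ (retreats e)) = caught t (proj₁ (staggered-wall false cops)) e

    -- Stepping back moves one free column from behind him to
    -- ahead of him; stepping forward does the opposite.
    backOff : ∀ t w g h m x →
              copsAt (suc t) ≗ formation w w m (suc h + (suc g + w)) → suc h + (suc g + w) ≤ N →
              robberAt (suc t) ≡ vx x (g + w) → Win ⊎ Cornered (suc t) (g + h)
    backOff t w zero    h m x cops fits e = inj₁ (caught t (wall-occupies cops x) e)
    backOff t w (suc g) h m x cops fits e =
      inj₂ (position w _ _ g (suc h) m x cops e refl (+-suc (suc h) (suc g + w)) (+-suc g h) fits)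

    pressOn : ∀ t w g h m x →
              copsAt (suc t) ≗ formation w w m (suc h + (suc g + w)) → suc h + (suc g + w) ≤ N →
              (h ≡ 0 → m ≡ x) → robberAt (suc t) ≡ vx x (suc (suc g + w)) → Win ⊎ Cornered (suc t) (g + h)
    pressOn t w g zero m x cops fits guard e with guard refl
    ... | refl = inj₁ (caught t (fsuc (fsuc fzero) , cops (fsuc (fsuc fzero))) e)
    pressOn t w g (suc h) m x cops fits guard e =
      inj₂ (position w _ _ (suc g) h m x cops e refl
                     (sym (cong suc (+-suc h (suc (g + w))))) (sym (+-suc g h)) fits)

    robberReply : ∀ {t s} → Closing t s → Win ⊎ Cornered (suc t) s
    robberReply {t} (closing (position w _ _ g h m x cops here refl refl refl fits) guard)
      with reply t x (robber<N g h w fits) here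
    ... | inj₁ win          = inj₁ win
    ... | inj₂ (stays e)    = inj₂ (position w _ _ g h m x       cops e refl refl refl fits)
    ... | inj₂ (crosses e)  = inj₂ (position w _ _ g h m (not x) cops e refl refl refl fits)
    ... | inj₂ (advances e) = pressOn t w g h m x cops fits guard e
    ... | inj₂ (retreats e) = backOff t w g h m x cops fits e

    -- After the wall advances, the robber has one free column less behind him.
    pushed : ∀ t w g m' x h' →
             copsAt (suc t) ≗ formation (suc w) (suc w) m' (suc h' + (suc (suc g) + w)) →
             robberAt t ≡ vx x (suc (suc g) + w) → suc h' + (suc (suc g) + w) ≤ N →
             (h' ≡ 0 → m' ≡ x) → Closing t (g + h')
    pushed t w g m' x h' moved here fits guard =
      closing (position (suc w) _ _ g h' m' x moved here (sym (+-suc (suc g) w)) refl refl fits) guard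

    closeIn : ∀ t w g h m x (same? : Dec (m ≡ x)) →
              robberAt t ≡ vx x (suc g + w) → suc h + (suc g + w) ≤ N →
              copsAt (suc t) ≗ after (aligned g h (does same?) x) w w m (suc h + (suc g + w)) →
              Win ⊎ ∃ λ s' → s' < g + h × Closing t s'
    closeIn t w zero zero m x same? here fits moved =
      inj₁ (surroundedByMove t (subst (Surrounded (copsAt (suc t))) (sym here)
                                      (squeezed false (robber<N 0 0 w fits) moved)))
    closeIn t w zero (suc zero) m x (no m≢x) here fits moved = inj₁ (staggeredWins t w x moved here fits)
    closeIn t w zero (suc zero) m x (yes refl) here fits moved =
      inj₂ (0 , ℕ.n<1+n 0 , closing (position w _ _ 0 0 m m moved here refl refl refl (shorten fits)) (λ _ → refl))
    closeIn t w zero (suc (suc h)) m x same? here fits moved =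
      inj₂ (suc h , ℕ.n<1+n _ , closing (position w _ _ 0 (suc h) m x moved here refl refl refl (shorten fits)) λ ())
    closeIn t w (suc g) (suc (suc h)) m x same? here fits moved =
      inj₂ (g + suc h , shrink g (n≤1+n _) , pushed t w g m x (suc h) moved here (shorten fits) λ ())
    closeIn t w (suc g) (suc zero) m x (yes refl) here fits moved =
      inj₂ (g + 0 , shrink g z≤n , pushed t w g m m 0 moved here (shorten fits) (λ _ → refl))
    closeIn t w (suc g) (suc zero) m x (no m≢x) here fits moved =
      inj₂ (g + 1 , shrink g ℕ.≤-refl , pushed t w g x x 1 moved here fits λ ())
    closeIn t w (suc g) zero m x same? here fits moved =
      inj₂ (g + 0 , shrink g ℕ.≤-refl , pushed t w g x x 0 moved here fits (λ _ → refl))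

    copsAdvance : ∀ {t s} → Cornered t s → Win ⊎ ∃ λ s' → s' < s × Closing t s'
    copsAdvance {t} (position w _ _ g h m x cops here refl refl refl fits) =
      closeIn t w g h m x (m Bool.≟ x) here fits (aligned-reply cops here fits)

    -- Each round the robber's room shrinks, so the cops win within μ rounds.
    trap : ∀ μ {t s} → s < μ → Cornered t s → Win
    trap (suc μ) {t} s<μ K with copsAdvance {t} K
    ... | inj₁ win = win
    ... | inj₂ (s' , s'<s , L) with robberReply {t} L
    ...   | inj₁ win = win
    ...   | inj₂ K'  = trap μ {suc t} (≤-trans s'<s (ℕ.≤-pred s<μ)) K'

    cornered₀ : ∀ x k → suc k < N → robberAt 0 ≡ vx x (suc k) → Win
    cornered₀ x k k+1<N here =
      trap (suc (k + h)) {0} ℕ.≤-refl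
        (position 0 (suc k) N k h true x (λ _ → refl) here
                  (sym (+-identityʳ (suc k))) (trans (sym (m∸n+n≡m k+1<N)) (+-suc h (suc k))) refl ℕ.≤-refl)
      where h = N ∸ suc (suc k)

    opening : ∀ u → robberAt 0 ≡ u → Win
    opening (a fzero)    start = zero , inj₁ (fzero , sym start)
    opening (b fzero)    start = zero , inj₁ (fsuc fzero , sym start)
    opening (a (fsuc i)) start = cornered₀ true  (toℕ i) (s≤s (toℕ<n i)) (trans start (cong a (sym (cl-toℕ (fsuc i)))))
    opening (b (fsuc i)) start = cornered₀ false (toℕ i) (s≤s (toℕ<n i)) (trans start (cong b (sym (cl-toℕ (fsuc i)))))

    win : Win
    win = opening (robberAt 0) refl

  copsWin : CopsWin 3
  copsWin = strategy , Pursuit.win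

theorem28 : (n : ℕ) → 3 ≤ n → Game.IsSurroundingCopNumber (GPAdj n) 3
theorem28 (suc (suc (suc n'))) _ = copsWin , λ k _ k<3 → fewCopsLose (a fzero) k<3
  where
  open Prism n'
  open FewCopsLose {Adj = GPAdj N} _≟V_ nbr nbr-adjacent nbr-distinct
theorem28 zero                ()
theorem28 (suc zero)          (s≤s ())
theorem28 (suc (suc zero))    (s≤s (s≤s ()))
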